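{- Let $\Pi$ be a logic program over a vocabulary $\sigma$, let $\iota\subseteq\sigma$ be a vocabulary with $hd(\Pi)\cap\iota=\emptyset$, and let $X$ be a set of atoms over $\sigma$ that is a model of the input completion $IComp(\Pi,\iota)$. Then $X$ is an input answer set of $\Pi$ relative to $\iota$ if and only if there is a level ranking of $X$ for $\Pi$ relative to $\iota$.
   Context: A logic program $\Pi$ over a vocabulary (set of atoms) $\sigma$ is a set of rules $a\leftarrow b_1,\ldots,b_\ell,\ not\ b_{\ell+1},\ldots,\ not\ b_m,\ not\ not\ b_{m+1},\ldots,\ not\ not\ b_n$ ($a\in\sigma$ or $a=\bot$, $b_i\in\sigma$), identified with the formula $B\rightarrow a$ where the body is $B=b_1\wedge\cdots\wedge b_\ell\wedge\neg b_{\ell+1}\wedge\cdots\wedge\neg b_m\wedge\neg\neg b_{m+1}\wedge\cdots\wedge\neg\neg b_n$; $B^+=\{b_1,\dots,b_\ell\}$ is its positive part and the remaining conjuncts its negative part. Sets of atoms are identified with assignments making exactly their atoms true. $hd(\Pi)$: heads of rules that are atoms; $Bodies(\Pi,a)$: bodies of rules with head $a$. The reduct $\Pi^X$ deletes each rule whose negative part $X$ does not satisfy and replaces the rest by $a\leftarrow b_1,\dots,b_\ell$; $X$ is an answer set of $\Pi$ if it is a minimal set satisfying all rules of $\Pi^X$. For $\iota\subseteq\sigma$ with $hd(\Pi)\cap\iota=\emptyset$: $X\subseteq\sigma$ is an input answer set of $\Pi$ relative to $\iota$ if $X$ is an answer set of $\Pi\cup\{a.\mid a\in X\cap\iota\}$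 (facts); $IComp(\Pi,\iota)$ is the set of formulas consisting of the rules of $\Pi$ and the implications $a\rightarrow\bigvee_{B\in Bodies(\Pi,a)}B$ for all $a\in\sigma\setminus\iota$ (empty disjunction $=\bot$); a level ranking of $X$ for $\Pi$ relative to $\iota$ is a function $lr:X\setminus\iota\to\mathbb{N}$ such that for each $a\in X\setminus\iota$ there is $B\in Bodies(\Pi,a)$ with $X$ satisfying $B$ and $lr(a)-1\geq lr(b)$ for every $b\in B^+\setminus\iota$. -}

module Defs where

open import Data.Nat using (ℕ; _<_)
open import Data.Fin using (Fin)
open import Data.Bool using (Bool; true; false)
open import Data.Maybe using (Maybe; just; nothing)
open import Data.List using (List; []; _∷_; map; filter; _++_; allFin)
open import Data.Bool using (_∧_; T)
open import Relation.Nullary.Decidable using (T?)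
open import Data.List.Relation.Unary.All using (All)
open import Data.List.Relation.Unary.Any using (Any)
open import Data.List.Membership.Propositional using (_∈_)
open import Data.Product using (_×_; Σ; ∃; _,_)
open import Data.Empty using (⊥)
open import Relation.Binary.PropositionalEquality using (_≡_)

-- Vocabulary σ = Fin n (finite set of atoms).
-- A set of atoms (= an assignment) is a characteristic function.
AtomSet : ℕ → Set
AtomSet n = Fin n → Bool

_∈ₛ_ : {n : ℕ} → Fin n → AtomSet n → Set
a ∈ₛ X = X a ≡ true

_⊆ₛ_ : {n : ℕ} → AtomSet n → AtomSet n → Set
Y ⊆ₛ X = ∀ a → a ∈ₛ Y → a ∈ₛ X

-- A rule  a ← b1..bl, not b(l+1)..bm, not not b(m+1)..bn
-- head = nothing encodes a = ⊥.
record Rule (n : ℕ) : Set where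
  constructor rule
  field
    head   : Maybe (Fin n)
    pos    : List (Fin n)
    neg    : List (Fin n)
    negneg : List (Fin n)
open Rule public

Program : ℕ → Set
Program n = List (Rule n)

SatNeg : {n : ℕ} → AtomSet n → Rule n → Set
SatNeg X r = All (λ b → X b ≡ false) (neg r) × All (λ b → b ∈ₛ X) (negneg r)

SatBody : {n : ℕ} → AtomSet n → Rule n → Set
SatBody X r = All (λ b → b ∈ₛ X) (pos r) × SatNeg X r

SatHead : {n : ℕ} → AtomSet n → Maybe (Fin n) → Set
SatHead X nothing  = ⊥
SatHead X (just a) = a ∈ₛ X

SatRule : {n : ℕ} → AtomSet n → Rule n → Set
SatRule X r = SatBody X r → SatHead X (head r)

SatProgram : {n : ℕ} → AtomSet n → Program n → Set
SatProgram X Π = All (SatRule X) Π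

-- Reduct Π^X: keep rules whose negative part X satisfies,
-- replaced by  head ← pos.
-- Y satisfies all rules of Π^X:
SatReduct : {n : ℕ} → AtomSet n → Program n → AtomSet n → Set
SatReduct X Π Y =
  All (λ r → SatNeg X r → All (λ b → b ∈ₛ Y) (pos r) → SatHead Y (head r)) Π

IsAnswerSet : {n : ℕ} → Program n → AtomSet n → Set
IsAnswerSet {n} Π X =
  SatReduct X Π X × ((Y : AtomSet n) → Y ⊆ₛ X → SatReduct X Π Y → X ⊆ₛ Y)

HeadsDisjoint : {n : ℕ} → Program n → AtomSet n → Set
HeadsDisjoint Π ι = All (λ r → ∀ a → head r ≡ just a → ι a ≡ false) Π

fact : {n : ℕ} → Fin n → Rule n
fact a = rule (just a) [] [] []

inputFacts : {n : ℕ} → AtomSet n → AtomSet n → Program n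
inputFacts {n} ι X = map fact (filter (λ a → T? (X a ∧ ι a)) (allFin n))

IsInputAnswerSet : {n : ℕ} → Program n → AtomSet n → AtomSet n → Set
IsInputAnswerSet Π ι X = IsAnswerSet (Π ++ inputFacts ι X) X

ModelOfIComp : {n : ℕ} → Program n → AtomSet n → AtomSet n → Set
ModelOfIComp Π ι X =
  SatProgram X Π ×
  (∀ a → ι a ≡ false → a ∈ₛ X →
     Any (λ r → head r ≡ just a × SatBody X r) Π)

-- A level ranking of X for Π relative to ι: lr : X ∖ ι → ℕ such that for every
-- a ∈ X ∖ ι there is a rule a ← B of Π with X ⊨ B and lr(b) ≤ lr(a) - 1
-- (i.e. lr(b) < lr(a)) for all b ∈ B⁺ ∖ ι.
-- (b ∈ B⁺ and X ⊨ B imply b ∈ X, so lr(b) is defined on X ∖ ι.)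
IsLevelRanking : {n : ℕ} → Program n → (ι X : AtomSet n) →
                 ((a : Fin n) → a ∈ₛ X → ι a ≡ false → ℕ) → Set
IsLevelRanking Π ι X lr =
  ∀ a (aX : a ∈ₛ X) (aι : ι a ≡ false) →
    Any (λ r → head r ≡ just a × Σ (SatBody X r) λ _ →
           All (λ b → (bX : b ∈ₛ X) (bι : ι b ≡ false) → lr b bX bι < lr a aX aι)
               (pos r))
        Π

HasLevelRanking : {n : ℕ} → Program n → AtomSet n → AtomSet n → Set
HasLevelRanking {n} Π ι X =
  Σ ((a : Fin n) → a ∈ₛ X → ι a ≡ false → ℕ) λ lr → IsLevelRanking Π ι X lr

module Submission where

-- Write P for Π ∪ {a. ∣ a ∈ X ∩ ι}; X is an input answer set iff X is a minimal
-- model of the reduct P^X.  The input facts of P^X say exactly "X ∩ ι ⊆ Y".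
--
-- (⇐) A model of IComp(Π,ι) satisfies Π, hence its own reduct.  If Y ⊆ X is
--     another model of P^X, every atom of X ∖ ι lies in Y by well-founded
--     induction on its level: its ranked rule has a body whose positive atoms
--     are either inputs (in Y by the facts) or of smaller level.
-- (⇒) Iterate the immediate-consequence operator of P^X from ∅.  It is
--     monotone, so the stages grow, and since there are finitely many atom
--     sets the iteration reaches a post-fixpoint, which is a model of P^X inside
--     X, hence equal to X by minimality.  Ranking an atom by the first stage
--     containing it is a level ranking: the rule deriving it at stage L+1 has
--     its positive body in stage L.

open import Defs
open import Data.Nat using (ℕ; zero; suc; _≤_; _<_; z≤n; s≤s)
open import Data.Nat.Induction using (<-wellFounded)
open import Data.Fin using (Fin)
open import Data.Fin.Properties using (any?) renaming (_≟_ to _≟ᶠ_)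
open import Data.Fin.Subset using (Subset; _⊂_; _⊃_) renaming (_∈_ to _∈ˢ_)
open import Data.Fin.Subset.Induction using (⊃-wellFounded)
open import Data.Bool using (Bool; true; false; _∧_; if_then_else_)
open import Data.Bool.Properties using (T-≡; T-∧) renaming (_≟_ to _≟ᵇ_)
open import Data.Maybe using (just; nothing)
open import Data.Maybe.Properties using (just-injective) renaming (≡-dec to ≡-decᵐ)
open import Data.Vec using (tabulate)
open import Data.Vec.Properties using (lookup∘tabulate; lookup⇒[]=; []=⇒lookup)
open import Data.List using (_++_; allFin)
open import Data.List.Relation.Unary.All as All using (All; [])
open import Data.List.Relation.Unary.All.Properties using (++⁺; ++⁻)
open import Data.List.Relation.Unary.Any as Any using (Any)
import Data.List.Relation.Unary.Any.Properties as Anyₚ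
open import Data.List.Membership.Propositional using (_∈_; find)
open import Data.List.Membership.Propositional.Properties
  using (∈-map⁺; ∈-map⁻; ∈-filter⁺; ∈-filter⁻; ∈-allFin)
open import Data.Product using (_×_; Σ; ∃; _,_; proj₁; proj₂)
open import Data.Sum using (inj₁; inj₂)
open import Data.Empty using (⊥; ⊥-elim)
open import Function using (_∘_)
open import Function.Bundles using (_⇔_; mk⇔; Equivalence)
open import Induction.WellFounded using (Acc; acc)
open import Relation.Nullary using (Dec; yes; no; does)
open import Relation.Nullary.Decidable using (dec-true; T?; _×-dec_)
open import Relation.Binary.PropositionalEquality using (_≡_; refl; sym; trans; subst)

does-true⇒ : ∀ {p} {A : Set p} (d : Dec A) → does d ≡ true → A
does-true⇒ (yes a) _ = a
does-true⇒ (no _) ()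

module _ {n : ℕ} where

  ReductRule : AtomSet n → AtomSet n → Rule n → Set
  ReductRule X Y r = SatNeg X r → All (_∈ₛ Y) (pos r) → SatHead Y (head r)

  model⇒reductModel : ∀ {X} (Π : Program n) → SatProgram X Π → SatReduct X Π X
  model⇒reductModel Π = All.map (λ satRule negX posX → satRule (posX , negX))

module InputFacts {n : ℕ} (ι X : AtomSet n) where

  inputFact⁺ : ∀ {a} → a ∈ₛ X → ι a ≡ true → fact a ∈ inputFacts ι X
  inputFact⁺ aX aι =
    ∈-map⁺ fact (∈-filter⁺ (λ a → T? (X a ∧ ι a)) (∈-allFin _)
                 (Equivalence.from T-∧ (Equivalence.from T-≡ aX , Equivalence.from T-≡ aι)))

  inputFact⁻ : ∀ {r} → r ∈ inputFacts ι X →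
               ∃ λ a → r ≡ fact a × a ∈ₛ X × ι a ≡ true
  inputFact⁻ r∈ with ∈-map⁻ fact r∈
  ... | a , a∈ , refl with Equivalence.to T-∧
                             (proj₂ (∈-filter⁻ (λ a → T? (X a ∧ ι a)) {xs = allFin n} a∈))
  ... | aX , aι = a , refl , Equivalence.to T-≡ aX , Equivalence.to T-≡ aι

  inputFact-head : ∀ {r a} → r ∈ inputFacts ι X → head r ≡ just a → ι a ≡ true
  inputFact-head r∈ hd with inputFact⁻ r∈
  ... | b , refl , _ , bι with just-injective hd
  ... | refl = bι

  inputFacts-sat : ∀ {Y} → (∀ a → a ∈ₛ X → ι a ≡ true → a ∈ₛ Y) →
                   SatReduct X (inputFacts ι X) Y
  inputFacts-sat {Y} X∩ι⊆Y = All.tabulate fromFact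
    where
    fromFact : ∀ {r} → r ∈ inputFacts ι X → ReductRule X Y r
    fromFact r∈ with inputFact⁻ r∈
    ... | a , refl , aX , aι = λ _ _ → X∩ι⊆Y a aX aι

  inputFacts-force : ∀ {Y a} → SatReduct X (inputFacts ι X) Y →
                     a ∈ₛ X → ι a ≡ true → a ∈ₛ Y
  inputFacts-force red aX aι = All.lookup red (inputFact⁺ aX aι) ([] , []) []

module LevelRankingSufficient {n : ℕ} (Π : Program n) (ι X : AtomSet n)
         {lr : (a : Fin n) → a ∈ₛ X → ι a ≡ false → ℕ}
         (ranking : IsLevelRanking Π ι X lr) where

  open InputFacts ι X

  -- Every model Y of Π^X with X ∩ ι ⊆ Y contains each ranked atom; induction on
  -- the level, since the positive body of its ranked rule is made of input
  -- atoms and atoms of smaller level.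
  ranked∈ : ∀ {Y} → SatReduct X Π Y → (∀ a → a ∈ₛ X → ι a ≡ true → a ∈ₛ Y) →
            ∀ a (aX : a ∈ₛ X) (aι : ι a ≡ false) → Acc _<_ (lr a aX aι) → a ∈ₛ Y
  ranked∈ {Y} red inputs a aX aι (acc smaller) =
    All.lookupWith {R = λ _ → a ∈ₛ Y} fire red (ranking a aX aι)
    where
    bodyAtom : ∀ {b} → b ∈ₛ X →
               ((bX : b ∈ₛ X) (bι : ι b ≡ false) → lr b bX bι < lr a aX aι) → b ∈ₛ Y
    bodyAtom {b} bX lower = byInputStatus (ι b) refl
      where
      byInputStatus : (v : Bool) → ι b ≡ v → b ∈ₛ Y
      byInputStatus true  bι = inputs b bX bι
      byInputStatus false bι = ranked∈ red inputs b bX bι (smaller (lower bX bι))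

    fire : ∀ {r} → ReductRule X Y r →
           (head r ≡ just a × Σ (SatBody X r) λ _ →
             All (λ b → (bX : b ∈ₛ X) (bι : ι b ≡ false) → lr b bX bι < lr a aX aι) (pos r)) →
           a ∈ₛ Y
    fire rr (hd , (posX , negX) , lower) =
      subst (SatHead Y) hd (rr negX (All.zipWith (λ (bX , l) → bodyAtom bX l) (posX , lower)))

  levelRanking⇒inputAnswerSet : SatProgram X Π → IsInputAnswerSet Π ι X
  levelRanking⇒inputAnswerSet satΠ =
    ++⁺ (model⇒reductModel Π satΠ) (inputFacts-sat (λ a aX _ → aX)) , minimal
    where
    minimal : (Y : AtomSet n) → Y ⊆ₛ X → SatReduct X (Π ++ inputFacts ι X) Y → X ⊆ₛ Y
    minimal Y _ red a aX with ++⁻ Π red | ι a in aι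
    ... | _ , redF    | true  = inputFacts-force redF aX aι
    ... | redΠ , redF | false =
      ranked∈ redΠ (λ _ → inputFacts-force redF) a aX aι (<-wellFounded _)

module _ {n : ℕ} where

  Derivable : AtomSet n → Program n → AtomSet n → Fin n → Set
  Derivable X P Y a = Any (λ r → head r ≡ just a × SatNeg X r × All (_∈ₛ Y) (pos r)) P

  derivable? : ∀ X P Y a → Dec (Derivable X P Y a)
  derivable? X P Y a = Any.any? (λ r →
        ≡-decᵐ _≟ᶠ_ (head r) (just a)
    ×-dec (All.all? (λ b → X b ≟ᵇ false) (neg r) ×-dec All.all? (λ b → X b ≟ᵇ true) (negneg r))
    ×-dec All.all? (λ b → Y b ≟ᵇ true) (pos r)) P

  consequence : AtomSet n → Program n → AtomSet n → AtomSet n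
  consequence X P Y a = does (derivable? X P Y a)

  consequence-mono : ∀ X P {Y Z} → Y ⊆ₛ Z → consequence X P Y ⊆ₛ consequence X P Z
  consequence-mono X P {Y} {Z} Y⊆Z a aTY =
    dec-true (derivable? X P Z a)
      (Any.map (λ (hd , negX , posY) → hd , negX , All.map (λ {b} → Y⊆Z b) posY)
               (does-true⇒ (derivable? X P Y a) aTY))

  consequence-below : ∀ {X P Y} → SatReduct X P X → Y ⊆ₛ X → consequence X P Y ⊆ₛ X
  consequence-below {X} {P} {Y} redX Y⊆X a aTY =
    All.lookupWith {R = λ _ → a ∈ₛ X} fire redX (does-true⇒ (derivable? X P Y a) aTY)
    where
    fire : ∀ {r} → ReductRule X X r → head r ≡ just a × SatNeg X r × All (_∈ₛ Y) (pos r) →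
           a ∈ₛ X
    fire rr (hd , negX , posY) = subst (SatHead X) hd (rr negX (All.map (λ {b} → Y⊆X b) posY))

  -- A post-fixpoint of the operator below X is a model of P^X: rules with an
  -- atomic head are closed by the post-fixpoint property, constraints already
  -- fail below X.
  postfix⇒reductModel : ∀ {X Y} (P : Program n) → SatReduct X P X → Y ⊆ₛ X →
                        consequence X P Y ⊆ₛ Y → SatReduct X P Y
  postfix⇒reductModel {X} {Y} P redX Y⊆X closed = All.tabulate fire
    where
    fire : ∀ {r} → r ∈ P → ReductRule X Y r
    fire {r} r∈ negX posY with head r in hd
    ... | nothing = subst (SatHead X) hd (All.lookup redX r∈ negX (All.map (λ {b} → Y⊆X b) posY))
    ... | just a  = closed a (dec-true (derivable? X P Y a)
                                (Any.map (λ { refl → hd , negX , posY }) r∈))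

  -- Atom sets as finite subsets, to use well-foundedness of strict inclusion;
  -- an atom set grows strictly when it gains an atom.
  asSubset : AtomSet n → Subset n
  asSubset = tabulate

  ∈-asSubset⁺ : ∀ {Y a} → a ∈ₛ Y → a ∈ˢ asSubset Y
  ∈-asSubset⁺ {Y} {a} aY = lookup⇒[]= a (asSubset Y) (trans (lookup∘tabulate Y a) aY)

  ∈-asSubset⁻ : ∀ {Y a} → a ∈ˢ asSubset Y → a ∈ₛ Y
  ∈-asSubset⁻ {Y} {a} aY = trans (sym (lookup∘tabulate Y a)) ([]=⇒lookup aY)

  strict-growth : ∀ {Y Z a} → Y ⊆ₛ Z → a ∈ₛ Z → Y a ≡ false → asSubset Y ⊂ asSubset Z
  strict-growth Y⊆Z aZ aY =
    (λ bY → ∈-asSubset⁺ (Y⊆Z _ (∈-asSubset⁻ bY))) ,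
    _ , ∈-asSubset⁺ aZ , λ aY′ → absurd (trans (sym aY) (∈-asSubset⁻ aY′))
    where
    absurd : false ≡ true → ⊥
    absurd ()

-- Iterating a monotone operator on atom sets from ∅ reaches a post-fixpoint:
-- the stages form an increasing chain of subsets of a finite set.
module Iteration {n : ℕ} (T : AtomSet n → AtomSet n)
                 (mono : ∀ {Y Z} → Y ⊆ₛ Z → T Y ⊆ₛ T Z) where

  stage : ℕ → AtomSet n
  stage zero    _ = false
  stage (suc k)   = T (stage k)

  stage-grows : ∀ k → stage k ⊆ₛ stage (suc k)
  stage-grows zero    _ ()
  stage-grows (suc k)   = mono (stage-grows k)

  stage-below : ∀ {X} → (∀ {Y} → Y ⊆ₛ X → T Y ⊆ₛ X) → ∀ k → stage k ⊆ₛ X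
  stage-below below zero    _ ()
  stage-below below (suc k)   = below (stage-below below k)

  -- While a new atom appears the stage grows strictly, which cannot go on forever.
  postfixpoint : ∃ λ N → T (stage N) ⊆ₛ stage N
  postfixpoint = climb 0 (⊃-wellFounded _)
    where
    climb : ∀ k → Acc _⊃_ (asSubset (stage k)) → ∃ λ N → T (stage N) ⊆ₛ stage N
    climb k (acc larger)
      with any? (λ a → (stage (suc k) a ≟ᵇ true) ×-dec (stage k a ≟ᵇ false))
    ... | yes (a , new , old) = climb (suc k) (larger (strict-growth (stage-grows k) new old))
    ... | no noNew = k , closed
      where
      closed : T (stage k) ⊆ₛ stage k
      closed a new with stage k a in old
      ... | true  = refl
      ... | false = ⊥-elim (noNew (a , new , old))

-- least f N: the least k ≤ N with f k ≡ true (N if there is none); it bounds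
-- every witness from below and is itself a witness whenever N is.
least : (ℕ → Bool) → ℕ → ℕ
least f zero    = zero
least f (suc N) = if f zero then zero else suc (least (f ∘ suc) N)

least-≤ : ∀ (f : ℕ → Bool) N {k} → f k ≡ true → least f N ≤ k
least-≤ f zero    _  = z≤n
least-≤ f (suc N) {zero} fk rewrite fk = z≤n
least-≤ f (suc N) {suc k} fk with f zero
... | true  = z≤n
... | false = s≤s (least-≤ (f ∘ suc) N fk)

least-holds : ∀ (f : ℕ → Bool) N → f N ≡ true → f (least f N) ≡ true
least-holds f zero    fN = fN
least-holds f (suc N) fN with f zero in f0
... | true  = f0
... | false = least-holds (f ∘ suc) N fN

-- (⇒)  An input answer set is ranked by the stage at which the least model of
-- its reduct derives each atom.
module AnswerSetRanked {n : ℕ} (Π : Program n) (ι X : AtomSet n)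
                       (answer : IsInputAnswerSet Π ι X) where

  open InputFacts ι X

  P : Program n
  P = Π ++ inputFacts ι X

  open Iteration (consequence X P) (consequence-mono X P)

  stage⊆X : ∀ k → stage k ⊆ₛ X
  stage⊆X = stage-below (consequence-below (proj₁ answer))

  N : ℕ
  N = proj₁ postfixpoint

  X⊆stage : X ⊆ₛ stage N
  X⊆stage = proj₂ answer (stage N) (stage⊆X N)
              (postfix⇒reductModel P (proj₁ answer) (stage⊆X N) (proj₂ postfixpoint))

  level : (a : Fin n) → a ∈ₛ X → ι a ≡ false → ℕ
  level a _ _ = least (λ k → stage k a) N

  -- A non-input atom of stage L is derived by a rule of Π (never by a fact)
  -- whose positive body lies in stage L - 1, hence has level below L.
  staged-ranked : ∀ a L → a ∈ₛ stage L → ι a ≡ false →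
    Any (λ r → head r ≡ just a × Σ (SatBody X r) λ _ →
           All (λ b → (bX : b ∈ₛ X) (bι : ι b ≡ false) → level b bX bι < L) (pos r)) Π
  staged-ranked a zero    () aι
  staged-ranked a (suc L) aL aι with Anyₚ.++⁻ Π (does-true⇒ (derivable? X P (stage L) a) aL)
  ... | inj₁ byΠ    = Any.map (λ (hd , negX , posL) →
          hd , (All.map (λ {b} → stage⊆X L b) posL , negX) ,
          All.map (λ {b} bL _ _ → s≤s (least-≤ (λ k → stage k b) N bL)) posL) byΠ
  ... | inj₂ byFact with find byFact
  ... | _ , r∈ , hd , _ with trans (sym aι) (inputFact-head r∈ hd)
  ... | ()

  levelRanking : HasLevelRanking Π ι X
  levelRanking = level , λ a aX aι →
    staged-ranked a _ (least-holds (λ k → stage k a) N (X⊆stage a aX)) aι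

theorem8 : (n : ℕ) (Π : Program n) (ι X : AtomSet n) →
    HeadsDisjoint Π ι →
    ModelOfIComp Π ι X →
    IsInputAnswerSet Π ι X ⇔ HasLevelRanking Π ι X
theorem8 n Π ι X _ (satΠ , _) =
  mk⇔ (AnswerSetRanked.levelRanking Π ι X)
      (λ (_ , ranking) → LevelRankingSufficient.levelRanking⇒inputAnswerSet Π ι X ranking satΠ)
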